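{- If $T$ is a tree with at least two vertices, then $\operatorname{gon}(T\,\square\,K_3)=3$.
   Context: $K_3$ is the complete graph on $3$ vertices. The Cartesian product $G\,\square\,H$ has vertex set $V(G)\times V(H)$, with $(u,u')$ adjacent to $(v,v')$ iff either $u'=v'$ and $uv\in E(G)$, or $u=v$ and $u'v'\in E(H)$. Divisors are integer combinations of vertices; $D\sim D'$ if $D-D'$ is in the image of the Laplacian ($\Delta_{v,v}=\mathrm{val}(v)$, $\Delta_{v,w}=-$number of edges between $v,w$). The rank $r(D)$ is $-1$ if no effective divisor is equivalent to $D$, and otherwise the largest $k$ such that for every effective divisor $F$ of degree $k$ some effective divisor is equivalent to $D-F$. $\operatorname{gon}(G)$ is the minimum degree of an effective divisor of rank $\ge1$. -}

module Defs where

open import Data.Nat as ℕ using (ℕ; zero; suc)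
open import Data.Integer as ℤ using (ℤ; +_; -_; _+_; _-_; _*_; _≤_)
open import Data.Fin using (Fin; zero; suc; _≟_; remQuot)
open import Data.Bool using (Bool; true; false; _∧_; _∨_; not; if_then_else_)
open import Data.Product using (Σ; ∃; _×_; _,_; proj₁; proj₂)
open import Data.List using (List; []; _∷_; _++_; [_]; length)
open import Data.List.Relation.Unary.Linked using (Linked)
open import Data.List.Relation.Unary.Unique.Propositional using (Unique)
open import Relation.Binary.PropositionalEquality using (_≡_)
open import Relation.Nullary using (¬_)
open import Relation.Nullary.Decidable using (⌊_⌋)

-- A (loopless, simple) graph on vertex set Fin n, given by a Boolean
-- adjacency function.  Symmetry / irreflexivity are imposed as hypotheses
-- where needed (IsSimple).
record Graph : Set where
  constructor mkGraph
  field
    size : ℕ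
    adj  : Fin size → Fin size → Bool
open Graph public

Adj : (G : Graph) → Fin (size G) → Fin (size G) → Set
Adj G u v = adj G u v ≡ true

IsSimple : Graph → Set
IsSimple G = (∀ u v → adj G u v ≡ adj G v u) × (∀ v → adj G v v ≡ false)

data Walk (G : Graph) : Fin (size G) → Fin (size G) → Set where
  here : ∀ {v} → Walk G v v
  step : ∀ {u w v} → Adj G u w → Walk G w v → Walk G u v

Connected : Graph → Set
Connected G = ∀ u v → Walk G u v

HasCycle : Graph → Set
HasCycle G = Σ (Fin (size G)) λ v₀ → Σ (List (Fin (size G))) λ rest →
  (2 ℕ.≤ length rest) × Unique (v₀ ∷ rest) × Linked (Adj G) (v₀ ∷ rest ++ [ v₀ ])

IsTree : Graph → Set
IsTree G = IsSimple G × Connected G × ¬ HasCycle G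

K₃ : Graph
K₃ = mkGraph 3 (λ i j → not ⌊ i ≟ j ⌋)

-- Cartesian product; vertex (u,u') of G □ H encoded in Fin (|G| * |H|) via remQuot
_□_ : Graph → Graph → Graph
G □ H = mkGraph (size G ℕ.* size H) adj□
  where
  adj□ : Fin (size G ℕ.* size H) → Fin (size G ℕ.* size H) → Bool
  adj□ x y with remQuot (size H) x | remQuot (size H) y
  ... | (u , u') | (v , v') =
        (⌊ u' ≟ v' ⌋ ∧ adj G u v) ∨ (⌊ u ≟ v ⌋ ∧ adj H u' v')

Σℤ : ∀ {n} → (Fin n → ℤ) → ℤ
Σℤ {zero}  f = + 0
Σℤ {suc n} f = f zero + Σℤ (λ i → f (suc i))

Divisor : Graph → Set
Divisor G = Fin (size G) → ℤ

deg : (G : Graph) → Divisor G → ℤ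
deg G D = Σℤ D

Effective : (G : Graph) → Divisor G → Set
Effective G D = ∀ v → + 0 ≤ D v

edges : (G : Graph) → Fin (size G) → Fin (size G) → ℤ
edges G u v = if adj G u v then + 1 else + 0

val : (G : Graph) → Fin (size G) → ℤ
val G v = Σℤ (λ w → edges G v w)

Δ : (G : Graph) → Fin (size G) → Fin (size G) → ℤ
Δ G v w = if ⌊ v ≟ w ⌋ then val G v else - edges G v w

Δ· : (G : Graph) → (Fin (size G) → ℤ) → Divisor G
Δ· G f v = Σℤ (λ w → Δ G v w * f w)

_∼_ : ∀ {G} → Divisor G → Divisor G → Set
_∼_ {G} D D' = ∃ λ (f : Fin (size G) → ℤ) → ∀ v → D v - D' v ≡ Δ· G f v

_-ᴰ_ : ∀ {G} → Divisor G → Divisor G → Divisor G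
(D -ᴰ F) v = D v - F v

RankAtLeast : (G : Graph) → Divisor G → ℕ → Set
RankAtLeast G D k = ∀ (F : Divisor G) → Effective G F → deg G F ≡ + k →
  ∃ λ (E : Divisor G) → Effective G E × (_∼_ {G} E (_-ᴰ_ {G} D F))

IsGonality : (G : Graph) → ℕ → Set
IsGonality G g =
  (∃ λ (D : Divisor G) → Effective G D × RankAtLeast G D 1 × deg G D ≡ + g)
  × (∀ (D : Divisor G) → Effective G D → RankAtLeast G D 1 → + g ≤ deg G D)

module Submission where

-- Upper bound.  The "fibre" divisor over a vertex w of T puts one chip on
-- each of the three vertices (w , i) of the copy of K₃ over w.  For a tree
-- edge ab, removing ab splits T in two sides; firing the lifted b-side moves
-- the fibre over a to the fibre over b.  Hence all fibres are equivalent,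
-- and since every vertex lies in some fibre, a fibre has rank ≥ 1.
--
-- Lower bound.  Let D be effective of rank ≥ 1.  Either the fibre over a
-- fixed vertex already carries three chips, or some vertex p has D p = 0.
-- Then D - p ∼ E ≥ 0, say E - (D - p) = Δ f.  On the set Min of minimisers
-- of f, each p ∈ Min carries at least as many chips of D as it has edges
-- leaving Min; a nonconstant f exists because D p = 0.  A case analysis in
-- T □ K₃ (a fibre that is partly in Min, or adjacent fibres that are
-- entirely in and entirely out of Min) always finds three edges leaving
-- Min, and their tails in Min carry three chips, so deg D ≥ 3.

open import Defs
open import Data.Nat as ℕ using (zero; suc; s≤s; z≤n)
open import Data.Integer as ℤ using (ℤ; +_; -_; _+_; _-_; _*_; _≤_; +≤+)
open import Data.Integer.Properties as ℤP hiding (_≟_)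
open import Data.Integer.Tactic.RingSolver using (solve-∀)
open import Data.Fin using (Fin; zero; suc; _≟_; combine; remQuot)
open import Data.Fin.Properties
  using (remQuot-combine; combine-remQuot; combine-injectiveˡ; combine-injectiveʳ; all?; any?; ¬∀⟶∃¬)
open import Data.Bool using (Bool; true; false; _∧_; _∨_; not; if_then_else_)
open import Data.Bool.Properties using (∨-identityʳ)
open import Data.Product using (Σ; ∃; _×_; _,_; proj₁; proj₂)
open import Data.Sum using (_⊎_; inj₁; inj₂)
open import Data.Empty using (⊥; ⊥-elim)
open import Data.List using (List; []; _∷_; _++_; [_]; length; allFin)
open import Data.List.Relation.Unary.All as All using (All; []; _∷_)
open import Data.List.Relation.Unary.All.Properties using (¬Any⇒All¬)
open import Data.List.Relation.Unary.AllPairs using ([]; _∷_)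
open import Data.List.Relation.Unary.Any using (here; there)
open import Data.List.Relation.Unary.Unique.Propositional using (Unique)
open import Data.List.Relation.Unary.Linked using (Linked; [-]; _∷_)
open import Data.List.Membership.Propositional using (_∈_)
open import Data.List.Membership.Propositional.Properties using (∈-allFin)
open import Data.List.Extrema ℤP.≤-totalOrder using (argmin; f[argmin]≤f[xs])
open import Relation.Binary.Construct.Closure.ReflexiveTransitive using (Star; ε; _◅_; _◅◅_; reverse)
open import Relation.Binary.PropositionalEquality hiding ([_])
open import Relation.Nullary using (¬_; yes; no; Dec)
open import Relation.Nullary.Decidable using (⌊_⌋; isYes≗does; dec-true; dec-false)

⌊≟⌋-yes : ∀ {m} {a b : Fin m} → a ≡ b → ⌊ a ≟ b ⌋ ≡ true
⌊≟⌋-yes {a = a} {b} a≡b = trans (isYes≗does (a ≟ b)) (dec-true (a ≟ b) a≡b)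

⌊≟⌋-no : ∀ {m} {a b : Fin m} → ¬ a ≡ b → ⌊ a ≟ b ⌋ ≡ false
⌊≟⌋-no {a = a} {b} a≢b = trans (isYes≗does (a ≟ b)) (dec-false (a ≟ b) a≢b)

zero-if-below-one : ∀ {i} → + 0 ≤ i → ¬ (+ 1 ≤ i) → i ≡ + 0
zero-if-below-one {+ zero} _ _ = refl
zero-if-below-one {+ suc n} _ i≱1 = ⊥-elim (i≱1 (+≤+ (s≤s z≤n)))

Σ-cong : ∀ {n} {f g : Fin n → ℤ} → (∀ i → f i ≡ g i) → Σℤ f ≡ Σℤ g
Σ-cong {zero} _ = refl
Σ-cong {suc n} f≗g = cong₂ _+_ (f≗g zero) (Σ-cong (λ i → f≗g (suc i)))

Σ-+ : ∀ {n} (f g : Fin n → ℤ) → Σℤ (λ i → f i + g i) ≡ Σℤ f + Σℤ g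
Σ-+ {zero} f g = refl
Σ-+ {suc n} f g =
  trans (cong (_+_ (f zero + g zero)) (Σ-+ (λ i → f (suc i)) (λ i → g (suc i))))
        (interchange (f zero) (g zero) _ _)
  where
  interchange : ∀ a b c d → (a + b) + (c + d) ≡ (a + c) + (b + d)
  interchange = solve-∀

Σ-neg : ∀ {n} (f : Fin n → ℤ) → Σℤ (λ i → - f i) ≡ - Σℤ f
Σ-neg {zero} f = refl
Σ-neg {suc n} f =
  trans (cong (_+_ (- f zero)) (Σ-neg (λ i → f (suc i)))) (sym (neg-distrib-+ (f zero) _))

Σ-zero : ∀ {n} (f : Fin n → ℤ) → (∀ i → f i ≡ + 0) → Σℤ f ≡ + 0
Σ-zero {zero} f _ = refl
Σ-zero {suc n} f f≗0 =
  cong₂ _+_ (f≗0 zero) (Σ-zero (λ i → f (suc i)) (λ i → f≗0 (suc i)))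

Σ-single : ∀ {n} (f : Fin n → ℤ) (j : Fin n) → (∀ i → ¬ i ≡ j → f i ≡ + 0) → Σℤ f ≡ f j
Σ-single {suc n} f zero others =
  trans (cong (_+_ (f zero)) (Σ-zero (λ i → f (suc i)) (λ i → others (suc i) (λ ()))))
        (+-identityʳ (f zero))
Σ-single {suc n} f (suc j) others =
  trans (cong₂ _+_ (others zero (λ ()))
                   (Σ-single (λ i → f (suc i)) j (λ i i≢j → others (suc i) (λ { refl → i≢j refl }))))
        (+-identityˡ (f (suc j)))

Σ-mono : ∀ {n} (f g : Fin n → ℤ) → (∀ i → f i ≤ g i) → Σℤ f ≤ Σℤ g
Σ-mono {zero} f g _ = ≤-refl
Σ-mono {suc n} f g f≤g =
  +-mono-≤ (f≤g zero) (Σ-mono (λ i → f (suc i)) (λ i → g (suc i)) (λ i → f≤g (suc i)))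

δ : ∀ {n} → Fin n → Fin n → ℤ
δ a i = if ⌊ i ≟ a ⌋ then + 1 else + 0

δ-same : ∀ {n} (a : Fin n) → δ a a ≡ + 1
δ-same a = cong (if_then + 1 else + 0) (⌊≟⌋-yes refl)

δ-other : ∀ {n} {a i : Fin n} → ¬ i ≡ a → δ a i ≡ + 0
δ-other i≢a = cong (if_then + 1 else + 0) (⌊≟⌋-no i≢a)

δ-nonneg : ∀ {n} (a i : Fin n) → + 0 ≤ δ a i
δ-nonneg a i with ⌊ i ≟ a ⌋
... | true = +≤+ z≤n
... | false = +≤+ z≤n

Σ-δ-sift : ∀ {n} (a : Fin n) (g : Fin n → ℤ) → Σℤ (λ i → δ a i * g i) ≡ g a
Σ-δ-sift a g =
  trans (Σ-single _ a (λ i i≢a → trans (cong (_* g i) (δ-other i≢a)) (*-zeroˡ (g i))))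
        (trans (cong (_* g a) (δ-same a)) (*-identityˡ (g a)))

Σ-δ : ∀ {n} (a : Fin n) → Σℤ (δ a) ≡ + 1
Σ-δ a = trans (Σ-cong (λ i → sym (*-identityʳ (δ a i)))) (Σ-δ-sift a (λ _ → + 1))

-- Sums over a list of indices.  For a nonnegative function and a list
-- without repetitions, the list sum is bounded by the full sum; this is
-- how chips found at distinct vertices are added up.

ΣL : ∀ {n} → (Fin n → ℤ) → List (Fin n) → ℤ
ΣL D [] = + 0
ΣL D (x ∷ xs) = D x + ΣL D xs

mult : ∀ {n} → List (Fin n) → Fin n → ℤ
mult [] i = + 0
mult (x ∷ xs) i = δ x i + mult xs i

Σ-mult : ∀ {n} (D : Fin n → ℤ) (xs : List (Fin n)) → Σℤ (λ i → mult xs i * D i) ≡ ΣL D xs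
Σ-mult D [] = Σ-zero _ (λ i → *-zeroˡ (D i))
Σ-mult D (x ∷ xs) = begin
  Σℤ (λ i → (δ x i + mult xs i) * D i)
    ≡⟨ Σ-cong (λ i → *-distribʳ-+ (D i) (δ x i) (mult xs i)) ⟩
  Σℤ (λ i → δ x i * D i + mult xs i * D i)
    ≡⟨ Σ-+ (λ i → δ x i * D i) (λ i → mult xs i * D i) ⟩
  Σℤ (λ i → δ x i * D i) + Σℤ (λ i → mult xs i * D i)
    ≡⟨ cong₂ _+_ (Σ-δ-sift x D) (Σ-mult D xs) ⟩
  D x + ΣL D xs ∎
  where open ≡-Reasoning

mult-absent : ∀ {n} {i : Fin n} {xs} → All (λ y → ¬ i ≡ y) xs → mult xs i ≡ + 0
mult-absent [] = refl
mult-absent (i≢y ∷ i∉xs) = cong₂ _+_ (δ-other i≢y) (mult-absent i∉xs)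

mult-unique : ∀ {n} {xs : List (Fin n)} → Unique xs → ∀ i → mult xs i ≡ + 0 ⊎ mult xs i ≡ + 1
mult-unique [] i = inj₁ refl
mult-unique {xs = x ∷ xs} (x∉xs ∷ xs-unique) i with i ≟ x
... | yes refl = inj₂ (cong (_+_ (+ 1)) (mult-absent x∉xs))
... | no _ = subst (λ m → m ≡ + 0 ⊎ m ≡ + 1) (sym (+-identityˡ (mult xs i))) (mult-unique xs-unique i)

ΣL-≤-Σ : ∀ {n} {D : Fin n → ℤ} → (∀ i → + 0 ≤ D i) → ∀ {xs} → Unique xs → ΣL D xs ≤ Σℤ D
ΣL-≤-Σ {D = D} D≥0 {xs} xs-unique = subst (_≤ Σℤ D) (Σ-mult D xs) (Σ-mono _ D termwise)
  where
  termwise : ∀ i → mult xs i * D i ≤ D i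
  termwise i with mult-unique xs-unique i
  ... | inj₁ m≡0 = subst (_≤ D i) (sym (trans (cong (_* D i) m≡0) (*-zeroˡ (D i)))) (D≥0 i)
  ... | inj₂ m≡1 = ≤-reflexive (trans (cong (_* D i) m≡1) (*-identityˡ (D i)))

ΣL-units : ∀ {n} {D : Fin n → ℤ} {xs} → All (λ x → + 1 ≤ D x) xs → + length xs ≤ ΣL D xs
ΣL-units [] = ≤-refl
ΣL-units (one ∷ ones) = +-mono-≤ one (ΣL-units ones)

module ThreeChips {n} {D : Fin n → ℤ} (D≥0 : ∀ i → + 0 ≤ D i) where

  chips-3 : ∀ p → + 3 ≤ D p → + 3 ≤ Σℤ D
  chips-3 p three = ≤-trans (+-mono-≤ three ≤-refl) (ΣL-≤-Σ D≥0 {p ∷ []} ([] ∷ []))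

  chips-21 : ∀ p q → ¬ p ≡ q → + 2 ≤ D p → + 1 ≤ D q → + 3 ≤ Σℤ D
  chips-21 p q p≢q two one =
    ≤-trans (+-mono-≤ two (+-mono-≤ one ≤-refl)) (ΣL-≤-Σ D≥0 ((p≢q ∷ []) ∷ [] ∷ []))

  chips-111 : ∀ p q r → ¬ p ≡ q → ¬ p ≡ r → ¬ q ≡ r →
              + 1 ≤ D p → + 1 ≤ D q → + 1 ≤ D r → + 3 ≤ Σℤ D
  chips-111 p q r p≢q p≢r q≢r one₁ one₂ one₃ =
    ≤-trans (+-mono-≤ one₁ (+-mono-≤ one₂ (+-mono-≤ one₃ ≤-refl)))
            (ΣL-≤-Σ D≥0 ((p≢q ∷ p≢r ∷ []) ∷ (q≢r ∷ []) ∷ [] ∷ []))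

degree-one : ∀ {n} (F : Fin n → ℤ) → (∀ i → + 0 ≤ F i) → Σℤ F ≡ + 1 →
             ∃ λ x → ∀ z → F z ≡ δ x z
degree-one F F≥0 degF≡1 with any? (λ i → + 1 ≤? F i)
... | no none = ⊥-elim (1≢0 (trans (sym degF≡1) (Σ-zero F empty)))
  where
  empty : ∀ i → F i ≡ + 0
  empty i = zero-if-below-one (F≥0 i) (λ one → none (i , one))
  1≢0 : ¬ (+ 1 ≡ + 0)
  1≢0 ()
... | yes (x , Fx≥1) = x , chip-at-x
  where
  within : ∀ {xs} → Unique xs → ΣL F xs ≤ + 1
  within {xs} u = subst (ΣL F xs ≤_) degF≡1 (ΣL-≤-Σ F≥0 u)

  Fx≡1 : F x ≡ + 1
  Fx≡1 = ≤-antisym (subst (_≤ + 1) (+-identityʳ (F x)) (within {x ∷ []} ([] ∷ []))) Fx≥1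

  empty-elsewhere : ∀ z → ¬ z ≡ x → ¬ (+ 1 ≤ F z)
  empty-elsewhere z z≢x Fz≥1 with ≤-trans (+-mono-≤ Fx≥1 (+-mono-≤ Fz≥1 ≤-refl))
                                          (within ((((λ x≡z → z≢x (sym x≡z)) ∷ []) ∷ [] ∷ [])))
  ... | +≤+ (s≤s ())

  chip-at-x : ∀ z → F z ≡ δ x z
  chip-at-x z with z ≟ x
  ... | yes refl = Fx≡1
  ... | no z≢x = zero-if-below-one (F≥0 z) (empty-elsewhere z z≢x)

minimiser : ∀ {m} → Fin m → (f : Fin m → ℤ) → ∃ λ v → ∀ z → f v ≤ f z
minimiser p f = argmin f p (allFin _) , λ z → All.lookup (f[argmin]≤f[xs] {f = f} p (allFin _)) (∈-allFin z)

edges-adj : (G : Graph) → ∀ {v w} → Adj G v w → edges G v w ≡ + 1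
edges-adj G v~w = cong (if_then + 1 else + 0) v~w

adj-distinct : (G : Graph) → (∀ v → adj G v v ≡ false) → ∀ {v w} → Adj G v w → ¬ v ≡ w
adj-distinct G loopless {v} v~w refl with trans (sym v~w) (loopless v)
... | ()

edges-cases : (G : Graph) → ∀ v w → edges G v w ≡ + 0 ⊎ Adj G v w
edges-cases G v w with adj G v w
... | true = inj₂ refl
... | false = inj₁ refl

Δ·-as-flow : (G : Graph) → (∀ v → adj G v v ≡ false) → ∀ (f : Fin (size G) → ℤ) v →
             Δ· G f v ≡ Σℤ (λ w → edges G v w * (f v - f w))
Δ·-as-flow G loopless f v = begin
  Σℤ (λ w → Δ G v w * f w)
    ≡⟨ Σ-cong row ⟩
  Σℤ (λ w → δ v w * (val G v * f v) + - (edges G v w * f w))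
    ≡⟨ Σ-+ (λ w → δ v w * (val G v * f v)) (λ w → - (edges G v w * f w)) ⟩
  Σℤ (λ w → δ v w * (val G v * f v)) + Σℤ (λ w → - (edges G v w * f w))
    ≡⟨ cong (_+ Σℤ (λ w → - (edges G v w * f w))) (Σ-δ-sift v (λ _ → val G v * f v)) ⟩
  val G v * f v + Σℤ (λ w → - (edges G v w * f w))
    ≡⟨ cong (_+ Σℤ (λ w → - (edges G v w * f w))) (sym (Σ-mult-const (λ w → edges G v w) (f v))) ⟩
  Σℤ (λ w → edges G v w * f v) + Σℤ (λ w → - (edges G v w * f w))
    ≡⟨ sym (Σ-+ (λ w → edges G v w * f v) (λ w → - (edges G v w * f w))) ⟩
  Σℤ (λ w → edges G v w * f v + - (edges G v w * f w))
    ≡⟨ Σ-cong (λ w → factor (edges G v w) (f v) (f w)) ⟩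
  Σℤ (λ w → edges G v w * (f v - f w)) ∎
  where
  open ≡-Reasoning
  factor : ∀ e a b → e * a + - (e * b) ≡ e * (a - b)
  factor = solve-∀
  Σ-mult-const : ∀ {n} (g : Fin n → ℤ) c → Σℤ (λ i → g i * c) ≡ Σℤ g * c
  Σ-mult-const {zero} g c = refl
  Σ-mult-const {suc n} g c =
    trans (cong (_+_ (g zero * c)) (Σ-mult-const (λ i → g (suc i)) c)) (sym (*-distribʳ-+ c (g zero) _))
  row : ∀ w → Δ G v w * f w ≡ δ v w * (val G v * f v) + - (edges G v w * f w)
  row w with v ≟ w
  ... | yes refl rewrite δ-same v | loopless v = diagonal (val G v * f v) (f v)
    where
    diagonal : ∀ a b → a ≡ + 1 * a + - (+ 0 * b)
    diagonal = solve-∀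
  ... | no v≢w rewrite δ-other {a = v} {i = w} (λ w≡v → v≢w (sym w≡v)) =
    trans (sym (neg-distribˡ-* (edges G v w) (f w))) (sym (+-identityˡ _))

Δ·-+ : (G : Graph) → ∀ (f g : Fin (size G) → ℤ) v → Δ· G (λ w → f w + g w) v ≡ Δ· G f v + Δ· G g v
Δ·-+ G f g v =
  trans (Σ-cong (λ w → *-distribˡ-+ (Δ G v w) (f w) (g w))) (Σ-+ (λ w → Δ G v w * f w) (λ w → Δ G v w * g w))

Δ·-zero : (G : Graph) → ∀ v → Δ· G (λ _ → + 0) v ≡ + 0
Δ·-zero G v = Σ-zero _ (λ w → *-zeroʳ (Δ G v w))

module MinimumCut (G : Graph) (loopless : ∀ x → adj G x x ≡ false)
  (D E F f : Fin (size G) → ℤ) (F≥0 : Effective G F) (E≥0 : Effective G E)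
  (E∼D-F : ∀ z → E z - (D z - F z) ≡ Δ· G f z)
  (v₀ : Fin (size G)) (v₀-min : ∀ z → f v₀ ≤ f z) where

  Min : Fin (size G) → Set
  Min p = f p ≤ f v₀

  Exit : Fin (size G) → Fin (size G) → Set
  Exit p q = Adj G p q × ¬ Min q

  flow : Fin (size G) → Fin (size G) → ℤ
  flow p w = edges G p w * (f w - f p)

  -- D p = E p + F p + Σ_w flow p w, and E p + F p ≥ 0
  flow≤D : ∀ p → Σℤ (flow p) ≤ D p
  flow≤D p = 0≤i-j⇒j≤i (subst (+ 0 ≤_) (sym surplus) (+-mono-≤ (E≥0 p) (F≥0 p)))
    where
    reverse-flow : ∀ e a b → e * (b - a) ≡ - (e * (a - b))
    reverse-flow = solve-∀
    Σflow : Σℤ (flow p) ≡ - (E p - (D p - F p))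
    Σflow = trans (Σ-cong (λ w → reverse-flow (edges G p w) (f p) (f w)))
                  (trans (Σ-neg (λ w → edges G p w * (f p - f w)))
                         (cong -_ (sym (trans (E∼D-F p) (Δ·-as-flow G loopless f p)))))
    rearrange : ∀ d e x → d - - (e - (d - x)) ≡ e + x
    rearrange = solve-∀
    surplus : D p - Σℤ (flow p) ≡ E p + F p
    surplus = trans (cong (_-_ (D p)) Σflow) (rearrange (D p) (E p) (F p))

  flow≥0 : ∀ p → Min p → ∀ w → + 0 ≤ flow p w
  flow≥0 p p-min w with edges-cases G p w
  ... | inj₁ e≡0 rewrite e≡0 = ≤-refl
  ... | inj₂ p~w rewrite edges-adj G p~w =
    subst (+ 0 ≤_) (sym (*-identityˡ _)) (i≤j⇒0≤j-i (≤-trans p-min (v₀-min w)))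

  flow≥1 : ∀ p → Min p → ∀ {q} → Exit p q → + 1 ≤ flow p q
  flow≥1 p p-min {q} (p~q , q-not-min) rewrite edges-adj G p~q =
    subst (+ 1 ≤_) (sym (*-identityˡ _)) (gap (≤-<-trans p-min (≰⇒> q-not-min)))
    where
    gap : ∀ {a b} → a ℤ.< b → + 1 ≤ b - a
    gap {a} {b} a<b = subst (_≤ b - a) (cancel a) (+-monoˡ-≤ (- a) (i<j⇒suc[i]≤j a<b))
      where
      cancel : ∀ a → + 1 + a - a ≡ + 1
      cancel = solve-∀

  cut-bound : ∀ p → Min p → ∀ qs → Unique qs → All (Exit p) qs → + length qs ≤ D p
  cut-bound p p-min qs qs-unique exits =
    ≤-trans (ΣL-units (All.map (flow≥1 p p-min) exits))
            (≤-trans (ΣL-≤-Σ (flow≥0 p p-min) qs-unique) (flow≤D p))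

  constant⇒F≤D : (∀ z → Min z) → ∀ p → F p ≤ D p
  constant⇒F≤D all-min p = 0≤i-j⇒j≤i (subst (+ 0 ≤_) E≡D-F (E≥0 p))
    where
    flat : ∀ w → f p - f w ≡ + 0
    flat w = i≡j⇒i-j≡0 (≤-antisym (≤-trans (all-min p) (v₀-min w)) (≤-trans (all-min w) (v₀-min p)))
    Δf≡0 : Δ· G f p ≡ + 0
    Δf≡0 = trans (Δ·-as-flow G loopless f p)
                 (Σ-zero _ (λ w → trans (cong (edges G p w *_) (flat w)) (*-zeroʳ (edges G p w))))
    E≡D-F : E p ≡ D p - F p
    E≡D-F = i-j≡0⇒i≡j (E p) (D p - F p) (trans (E∼D-F p) Δf≡0)

-- Vertices of T □ K₃: the vertex (u , i) is encoded as combine u i.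
module Product (T : Graph) where

  G : Graph
  G = T □ K₃

  V : Set
  V = Fin (size G)

  c : Fin (size T) → Fin 3 → V
  c = combine

  coords : ∀ x → c (proj₁ (remQuot {size T} 3 x)) (proj₂ (remQuot {size T} 3 x)) ≡ x
  coords = combine-remQuot {size T} 3

  base : V → Fin (size T)
  base x = proj₁ (remQuot {size T} 3 x)

  base-c : ∀ u i → base (c u i) ≡ u
  base-c u i = cong proj₁ (remQuot-combine {size T} {3} u i)

  elim : (P : V → Set) → (∀ u i → P (c u i)) → ∀ x → P x
  elim P on-coords x = subst P (coords x) (on-coords _ _)

  c-injˡ : ∀ {u i w j} → c u i ≡ c w j → u ≡ w
  c-injˡ {u} {i} {w} {j} = combine-injectiveˡ u i w j

  c-injʳ : ∀ {u i w j} → c u i ≡ c w j → i ≡ j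
  c-injʳ {u} {i} {w} {j} = combine-injectiveʳ u i w j

  adj-c : ∀ u i w j → adj G (c u i) (c w j) ≡ ((⌊ i ≟ j ⌋ ∧ adj T u w) ∨ (⌊ u ≟ w ⌋ ∧ not ⌊ i ≟ j ⌋))
  adj-c u i w j = cong₂ rule (remQuot-combine {size T} {3} u i) (remQuot-combine {size T} {3} w j)
    where
    rule : Fin (size T) × Fin 3 → Fin (size T) × Fin 3 → Bool
    rule (u , i) (w , j) = (⌊ i ≟ j ⌋ ∧ adj T u w) ∨ (⌊ u ≟ w ⌋ ∧ not ⌊ i ≟ j ⌋)

  loopless : (∀ v → adj T v v ≡ false) → ∀ x → adj G x x ≡ false
  loopless loopless-T = elim (λ x → adj G x x ≡ false) on-coords
    where
    on-coords : ∀ u i → adj G (c u i) (c u i) ≡ false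
    on-coords u i rewrite adj-c u i u i | ⌊≟⌋-yes (refl {x = i}) | ⌊≟⌋-yes (refl {x = u}) | loopless-T u = refl

  adj-fibre : ∀ u {i j} → ¬ i ≡ j → Adj G (c u i) (c u j)
  adj-fibre u {i} {j} i≢j rewrite adj-c u i u j | ⌊≟⌋-no i≢j | ⌊≟⌋-yes (refl {x = u}) = refl

  adj-layer : ∀ {u w} i → Adj T u w → Adj G (c u i) (c w i)
  adj-layer {u} {w} i u~w rewrite adj-c u i w i | ⌊≟⌋-yes (refl {x = i}) | u~w = refl

  adj-class : ∀ u i w j → Adj G (c u i) (c w j) → (i ≡ j × Adj T u w) ⊎ (u ≡ w × ¬ i ≡ j)
  adj-class u i w j c~c = by-cases (i ≟ j) (u ≟ w) (trans (sym (adj-c u i w j)) c~c)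
    where
    by-cases : ∀ (i? : Dec (i ≡ j)) (u? : Dec (u ≡ w)) →
               ((⌊ i? ⌋ ∧ adj T u w) ∨ (⌊ u? ⌋ ∧ not ⌊ i? ⌋)) ≡ true →
               (i ≡ j × Adj T u w) ⊎ (u ≡ w × ¬ i ≡ j)
    by-cases (yes i≡j) (yes _) layer = inj₁ (i≡j , trans (sym (∨-identityʳ _)) layer)
    by-cases (yes i≡j) (no _) layer = inj₁ (i≡j , trans (sym (∨-identityʳ _)) layer)
    by-cases (no i≢j) (yes u≡w) _ = inj₂ (u≡w , i≢j)
    by-cases (no _) (no _) ()

  fibre≢ : ∀ {u w i j} → ¬ i ≡ j → ¬ c u i ≡ c w j
  fibre≢ i≢j e = i≢j (c-injʳ e)

  layer≢ : ∀ {u w i j} → ¬ u ≡ w → ¬ c u i ≡ c w j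
  layer≢ u≢w e = u≢w (c-injˡ e)

i₀ i₁ i₂ : Fin 3
i₀ = zero
i₁ = suc zero
i₂ = suc (suc zero)

third : (i j : Fin 3) → ¬ i ≡ j → ∃ λ k → ¬ i ≡ k × ¬ j ≡ k
third zero zero i≢j = ⊥-elim (i≢j refl)
third zero (suc zero) _ = suc (suc zero) , (λ ()) , (λ ())
third zero (suc (suc zero)) _ = suc zero , (λ ()) , (λ ())
third (suc zero) zero _ = suc (suc zero) , (λ ()) , (λ ())
third (suc zero) (suc zero) i≢j = ⊥-elim (i≢j refl)
third (suc zero) (suc (suc zero)) _ = zero , (λ ()) , (λ ())
third (suc (suc zero)) zero _ = suc zero , (λ ()) , (λ ())
third (suc (suc zero)) (suc zero) _ = zero , (λ ()) , (λ ())
third (suc (suc zero)) (suc (suc zero)) i≢j = ⊥-elim (i≢j refl)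

module ProductCut (T : Graph) (symT : ∀ u v → adj T u v ≡ adj T v u)
  (loopless-T : ∀ v → adj T v v ≡ false)
  (connected : Connected T) (has-neighbour : ∀ u → ∃ λ w → Adj T u w)
  (D : Divisor (T □ K₃)) (D≥0 : Effective (T □ K₃) D)
  (Min : Fin (size (T □ K₃)) → Set) (Min? : ∀ x → Dec (Min x))
  (cut-bound : ∀ p → Min p → ∀ qs → Unique qs →
               All (λ q → Adj (T □ K₃) p q × ¬ Min q) qs → + length qs ≤ D p)
  where

  open Product T
  open ThreeChips D≥0

  Exit : V → V → Set
  Exit p q = Adj G p q × ¬ Min q

  exits-1 : ∀ p → Min p → ∀ {q} → Exit p q → + 1 ≤ D p
  exits-1 p p-min e = cut-bound p p-min _ ([] ∷ []) (e ∷ [])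

  exits-2 : ∀ p → Min p → ∀ {q₁ q₂} → ¬ q₁ ≡ q₂ → Exit p q₁ → Exit p q₂ → + 2 ≤ D p
  exits-2 p p-min q₁≢q₂ e₁ e₂ = cut-bound p p-min _ ((q₁≢q₂ ∷ []) ∷ [] ∷ []) (e₁ ∷ e₂ ∷ [])

  exits-3 : ∀ p → Min p → ∀ {q₁ q₂ q₃} → ¬ q₁ ≡ q₂ → ¬ q₁ ≡ q₃ → ¬ q₂ ≡ q₃ →
            Exit p q₁ → Exit p q₂ → Exit p q₃ → + 3 ≤ D p
  exits-3 p p-min q₁≢q₂ q₁≢q₃ q₂≢q₃ e₁ e₂ e₃ =
    cut-bound p p-min _ ((q₁≢q₂ ∷ q₁≢q₃ ∷ []) ∷ (q₂≢q₃ ∷ []) ∷ [] ∷ []) (e₁ ∷ e₂ ∷ e₃ ∷ [])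

  mixed-fibre : ∀ u i j → ¬ i ≡ j → Min (c u i) → ¬ Min (c u j) → + 3 ≤ Σℤ D
  mixed-fibre u i j i≢j in-i out-j with third i j i≢j | has-neighbour u
  ... | k , i≢k , j≢k | w , u~w = by-cases (Min? (c u k)) (Min? (c w i)) (Min? (c w j))
    where
    u≢w : ¬ u ≡ w
    u≢w = adj-distinct T loopless-T u~w
    w~u : Adj T w u
    w~u = trans (symT w u) u~w
    k→j : Adj G (c u k) (c u j)
    k→j = adj-fibre u (λ k≡j → j≢k (sym k≡j))
    by-cases : Dec (Min (c u k)) → Dec (Min (c w i)) → Dec (Min (c w j)) → + 3 ≤ Σℤ D
    by-cases (no out-k) (no out-wi) _ =
      chips-3 (c u i) (exits-3 (c u i) in-i (fibre≢ j≢k) (layer≢ u≢w) (layer≢ u≢w)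
                        (adj-fibre u i≢j , out-j) (adj-fibre u i≢k , out-k) (adj-layer i u~w , out-wi))
    by-cases (no out-k) (yes in-wi) (yes in-wj) =
      chips-21 (c u i) (c w j) (layer≢ u≢w)
        (exits-2 (c u i) in-i (fibre≢ j≢k) (adj-fibre u i≢j , out-j) (adj-fibre u i≢k , out-k))
        (exits-1 (c w j) in-wj (adj-layer j w~u , out-j))
    by-cases (no out-k) (yes in-wi) (no out-wj) =
      chips-21 (c u i) (c w i) (layer≢ u≢w)
        (exits-2 (c u i) in-i (fibre≢ j≢k) (adj-fibre u i≢j , out-j) (adj-fibre u i≢k , out-k))
        (exits-1 (c w i) in-wi (adj-fibre w i≢j , out-wj))
    by-cases (yes in-k) _ (yes in-wj) =
      chips-111 (c u i) (c u k) (c w j) (fibre≢ i≢k) (layer≢ u≢w) (layer≢ u≢w)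
        (exits-1 (c u i) in-i (adj-fibre u i≢j , out-j))
        (exits-1 (c u k) in-k (k→j , out-j))
        (exits-1 (c w j) in-wj (adj-layer j w~u , out-j))
    by-cases (yes in-k) (yes in-wi) (no out-wj) =
      chips-111 (c u i) (c u k) (c w i) (fibre≢ i≢k) (layer≢ u≢w) (layer≢ u≢w)
        (exits-1 (c u i) in-i (adj-fibre u i≢j , out-j))
        (exits-1 (c u k) in-k (k→j , out-j))
        (exits-1 (c w i) in-wi (adj-fibre w i≢j , out-wj))
    by-cases (yes in-k) (no out-wi) (no _) =
      chips-21 (c u i) (c u k) (fibre≢ i≢k)
        (exits-2 (c u i) in-i (layer≢ u≢w) (adj-fibre u i≢j , out-j) (adj-layer i u~w , out-wi))
        (exits-1 (c u k) in-k (k→j , out-j))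

  Full Empty : Fin (size T) → Set
  Full u = ∀ k → Min (c u k)
  Empty u = ∀ k → ¬ Min (c u k)

  full-or-empty : ∀ u → + 3 ≤ Σℤ D ⊎ (Full u ⊎ Empty u)
  full-or-empty u with all? (λ k → Min? (c u k))
  ... | yes full = inj₂ (inj₁ full)
  ... | no not-full with ¬∀⟶∃¬ 3 (λ k → Min (c u k)) (λ k → Min? (c u k)) not-full | any? (λ k → Min? (c u k))
  ...   | j , out-j | yes (i , in-i) = inj₁ (mixed-fibre u i j (λ { refl → out-j in-i }) in-i out-j)
  ...   | _ | no none = inj₂ (inj₂ (λ k in-k → none (k , in-k)))

  -- A full fibre next to an empty one: three layer edges leave Min.
  full-next-to-empty : ∀ {u w} → Adj T u w → Full u → Empty w → + 3 ≤ Σℤ D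
  full-next-to-empty {u} {w} u~w full empty =
    chips-111 (c u i₀) (c u i₁) (c u i₂) (fibre≢ (λ ())) (fibre≢ (λ ())) (fibre≢ (λ ()))
      (leaves i₀) (leaves i₁) (leaves i₂)
    where
    leaves : ∀ k → + 1 ≤ D (c u k)
    leaves k = exits-1 (c u k) (full k) (adj-layer k u~w , empty k)

  -- Walking from a full fibre to an empty one crosses a full/empty edge.
  full-to-empty : ∀ {u w} → Walk T u w → Full u → Empty w → + 3 ≤ Σℤ D
  full-to-empty here full empty = ⊥-elim (empty zero (full zero))
  full-to-empty (step {w = v} u~v rest) full empty with full-or-empty v
  ... | inj₁ three = three
  ... | inj₂ (inj₁ full-v) = full-to-empty rest full-v empty
  ... | inj₂ (inj₂ empty-v) = full-next-to-empty u~v full empty-v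

  three-chips : ∀ {x y} → Min x → ¬ Min y → + 3 ≤ Σℤ D
  three-chips {x} {y} in-x out-y =
    elim (λ x → Min x → + 3 ≤ Σℤ D)
      (λ u i in-ui → elim (λ y → ¬ Min y → + 3 ≤ Σℤ D) (λ w j → between u i w j in-ui) y out-y) x in-x
    where
    between : ∀ u i w j → Min (c u i) → ¬ Min (c w j) → + 3 ≤ Σℤ D
    between u i w j in-ui out-wj with full-or-empty u | full-or-empty w
    ... | inj₁ three | _ = three
    ... | _ | inj₁ three = three
    ... | inj₂ (inj₂ empty-u) | _ = ⊥-elim (empty-u i in-ui)
    ... | _ | inj₂ (inj₁ full-w) = ⊥-elim (out-wj (full-w j))
    ... | inj₂ (inj₁ full-u) | inj₂ (inj₂ empty-w) = full-to-empty (connected u w) full-u empty-w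

-- The side is constant along every other edge: otherwise the
-- two paths together with that edge would give a path from a to b avoiding
-- ab, which closes up with ab to a cycle.
module TreeCut (T : Graph) (symT : ∀ u v → adj T u v ≡ adj T v u)
  (loopless-T : ∀ v → adj T v v ≡ false) (connected : Connected T) (acyclic : ¬ HasCycle T)
  (a b : Fin (size T)) (a~b : Adj T a b) where

  open import Data.List.Membership.DecPropositional (_≟_ {size T}) using (_∈?_)

  V : Set
  V = Fin (size T)

  verts : ∀ {R : V → V → Set} {x z} → Star R x z → List V
  verts {x = x} ε = x ∷ []
  verts {x = x} (_ ◅ w) = x ∷ verts w

  end∈ : ∀ {R x z} (w : Star R x z) → z ∈ verts w
  end∈ ε = here refl
  end∈ (_ ◅ w) = there (end∈ w)

  start∈ : ∀ {R x z} (w : Star R x z) → x ∈ verts w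
  start∈ ε = here refl
  start∈ (_ ◅ _) = here refl

  Path : (V → V → Set) → V → V → Set
  Path R x z = Σ (Star R x z) (λ w → Unique (verts w))

  suffix : ∀ {R x y z} (w : Star R y z) → x ∈ verts w → Unique (verts w) → Path R x z
  suffix ε (here refl) w-unique = ε , w-unique
  suffix (r ◅ w) (here refl) w-unique = r ◅ w , w-unique
  suffix (_ ◅ w) (there x∈w) (_ ∷ w-unique) = suffix w x∈w w-unique

  loop-erase : ∀ {R x z} → Star R x z → Path R x z
  loop-erase ε = ε , [] ∷ []
  loop-erase {x = x} (r ◅ w) with loop-erase w
  ... | p , p-unique with x ∈? verts p
  ...   | yes x∈p = suffix p x∈p p-unique
  ...   | no x∉p = r ◅ p , ¬Any⇒All¬ (verts p) x∉p ∷ p-unique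

  avoiding : ∀ {R S : V → V → Set} (c : V) → (∀ {x y} → R x y → ¬ x ≡ c → ¬ y ≡ c → S x y) →
             ∀ {x z} (w : Star R x z) → ¬ c ∈ verts w → Star S x z
  avoiding c restrict ε _ = ε
  avoiding c restrict (r ◅ w) c∉ =
    restrict r (λ { refl → c∉ (here refl) }) (λ { refl → c∉ (there (start∈ w)) })
      ◅ avoiding c restrict w (λ c∈w → c∉ (there c∈w))

  prefix : ∀ {R x z} (w : Star R x z) → Unique (verts w) → ∀ {y} → y ∈ verts w → ¬ y ≡ z →
           Σ (Star R x y) λ p → ¬ z ∈ verts p
  prefix ε _ (here refl) y≢z = ⊥-elim (y≢z refl)
  prefix (_ ◅ w) (x∉w ∷ _) (here refl) _ = ε , λ { (here refl) → All.lookup x∉w (end∈ w) refl }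
  prefix (r ◅ w) (x∉w ∷ w-unique) (there y∈w) y≢z with prefix w w-unique y∈w y≢z
  ... | p , z∉p = r ◅ p , λ { (here refl) → All.lookup x∉w (end∈ w) refl ; (there z∈p) → z∉p z∈p }

  symAdj : ∀ {x y} → Adj T x y → Adj T y x
  symAdj {x} {y} x~y = trans (symT y x) x~y

  a≢b : ¬ a ≡ b
  a≢b = adj-distinct T loopless-T a~b

  Adj⁻ : V → V → Set
  Adj⁻ x y = Adj T x y × ¬ (x ≡ a × y ≡ b) × ¬ (x ≡ b × y ≡ a)

  symAdj⁻ : ∀ {x y} → Adj⁻ x y → Adj⁻ y x
  symAdj⁻ (x~y , not-ab , not-ba) =
    symAdj x~y , (λ { (y≡a , x≡b) → not-ba (x≡b , y≡a) }) , (λ { (y≡b , x≡a) → not-ab (x≡a , y≡b) })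

  -- a path from a to b avoiding ab closes a cycle with ab
  no-detour : Path Adj⁻ a b → ⊥
  no-detour (ε , _) = a≢b refl
  no-detour (r ◅ ε , _) = proj₁ (proj₂ r) (refl , refl)
  no-detour (r ◅ r′ ◅ w , unique) =
    acyclic (a , verts (r′ ◅ w) , long r′ w , unique , closed (r ◅ r′ ◅ w) (symAdj a~b))
    where
    long : ∀ {x y z} (r : Adj⁻ x y) (w : Star Adj⁻ y z) → 2 ℕ.≤ length (verts (r ◅ w))
    long _ ε = s≤s (s≤s z≤n)
    long _ (_ ◅ _) = s≤s (s≤s z≤n)
    closed : ∀ {x y z} (w : Star Adj⁻ x y) → Adj T y z → Linked (Adj T) (verts w ++ [ z ])
    closed ε y~z = y~z ∷ [-]
    closed (r ◅ ε) y~z = proj₁ r ∷ y~z ∷ [-]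
    closed (r ◅ r′ ◅ w) y~z = proj₁ r ∷ closed (r′ ◅ w) y~z

  toStar : ∀ {x y} → Walk T x y → Star (Adj T) x y
  toStar here = ε
  toStar (step x~y w) = x~y ◅ toStar w

  path-to-a : ∀ v → Path (Adj T) v a
  path-to-a v = loop-erase (toStar (connected v a))

  side : V → Bool
  side v = ⌊ b ∈? verts (proj₁ (path-to-a v)) ⌋

  side-a : side a ≡ false
  side-a with b ∈? verts (proj₁ (path-to-a a))
  ... | yes b∈ = ⊥-elim (trivial-loop (path-to-a a) b∈)
    where
    trivial-loop : (p : Path (Adj T) a a) → ¬ b ∈ verts (proj₁ p)
    trivial-loop (ε , _) (here b≡a) = a≢b (sym b≡a)
    trivial-loop (_ ◅ w , a∉w ∷ _) _ = All.lookup a∉w (end∈ w) refl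
  ... | no _ = refl

  side-b : side b ≡ true
  side-b with b ∈? verts (proj₁ (path-to-a b))
  ... | yes _ = refl
  ... | no b∉ = ⊥-elim (b∉ (start∈ (proj₁ (path-to-a b))))

  -- an edge v~w other than ab with b on the path from w but not from v
  -- yields a detour a ⇝ v ~ w ⇝ b
  detour : ∀ {v w} → Adj⁻ v w → ¬ b ∈ verts (proj₁ (path-to-a v)) → b ∈ verts (proj₁ (path-to-a w)) → ⊥
  detour {v} {w} v~w b∉pv b∈pw = no-detour (loop-erase (reverse symAdj⁻ v-to-a ◅◅ (v~w ◅ w-to-b)))
    where
    v-to-a : Star Adj⁻ v a
    v-to-a = avoiding b (λ x~y x≢b y≢b → x~y , (λ { (_ , y≡b) → y≢b y≡b }) , (λ { (x≡b , _) → x≢b x≡b }))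
                        (proj₁ (path-to-a v)) b∉pv
    w-to-b : Star Adj⁻ w b
    w-to-b with prefix (proj₁ (path-to-a w)) (proj₂ (path-to-a w)) b∈pw (λ b≡a → a≢b (sym b≡a))
    ... | p , a∉p = avoiding a (λ x~y x≢a y≢a → x~y , (λ { (x≡a , _) → x≢a x≡a }) , (λ { (_ , y≡a) → y≢a y≡a }))
                               p a∉p

  side-const : ∀ {v w} → Adj⁻ v w → side v ≡ side w
  side-const {v} {w} v~w with b ∈? verts (proj₁ (path-to-a v)) | b ∈? verts (proj₁ (path-to-a w))
  ... | yes _ | yes _ = refl
  ... | no _ | no _ = refl
  ... | no b∉v | yes b∈w = ⊥-elim (detour v~w b∉v b∈w)
  ... | yes b∈v | no b∉w = ⊥-elim (detour (symAdj⁻ v~w) b∉w b∈v)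

module Fibres (T : Graph) (symT : ∀ u v → adj T u v ≡ adj T v u)
  (loopless-T : ∀ v → adj T v v ≡ false) (connected : Connected T) (acyclic : ¬ HasCycle T) where

  open Product T

  fibre : Fin (size T) → Divisor G
  fibre w z = δ w (base z)

  -- Firing the b-side of a tree edge ab moves the fibre over a to the fibre over b.
  module _ {a b : Fin (size T)} (a~b : Adj T a b) where

    open TreeCut T symT loopless-T connected acyclic a b a~b using (side; side-a; side-b; side-const; a≢b)

    height : Fin (size T) → ℤ
    height u = if side u then + 1 else + 0

    b-side : V → ℤ
    b-side z = height (base z)

    outflow : Fin (size T) → Fin 3 → V → ℤ
    outflow u i y = edges G (c u i) y * (b-side (c u i) - b-side y)

    outflow-c : ∀ u i w j → outflow u i (c w j) ≡ edges G (c u i) (c w j) * (height u - height w)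
    outflow-c u i w j =
      cong₂ (λ p q → edges G (c u i) (c w j) * (height p - height q)) (base-c u i) (base-c w j)

    -- only the two lifts of ab in layer i carry flow
    no-flow : ∀ u i w j → (i ≡ j → ¬ (u ≡ a × w ≡ b)) → (i ≡ j → ¬ (u ≡ b × w ≡ a)) →
              outflow u i (c w j) ≡ + 0
    no-flow u i w j not-ab not-ba with edges-cases G (c u i) (c w j)
    ... | inj₁ e≡0 = trans (outflow-c u i w j) (trans (cong (_* (height u - height w)) e≡0) (*-zeroˡ (height u - height w)))
    ... | inj₂ c~c with adj-class u i w j c~c
    ...   | inj₂ (refl , _) =
      trans (outflow-c u i u j)
            (trans (cong (edges G (c u i) (c u j) *_) (+-inverseʳ (height u))) (*-zeroʳ (edges G (c u i) (c u j))))
    ...   | inj₁ (refl , u~w) =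
      trans (outflow-c u i w i)
            (trans (cong (λ s → edges G (c u i) (c w i) * (height u - s)) (cong (if_then + 1 else + 0) (sym same-side)))
                   (trans (cong (edges G (c u i) (c w i) *_) (+-inverseʳ (height u))) (*-zeroʳ (edges G (c u i) (c w i)))))
      where
      same-side : side u ≡ side w
      same-side = side-const (u~w , not-ab refl , not-ba refl)

    edge-flow : ∀ {u w} i → Adj T u w → outflow u i (c w i) ≡ height u - height w
    edge-flow {u} {w} i u~w =
      trans (outflow-c u i w i)
            (trans (cong (_* (height u - height w)) (edges-adj G (adj-layer i u~w))) (*-identityˡ (height u - height w)))

    flow-sum : ∀ u i → Σℤ (outflow u i) ≡ δ b u - δ a u
    flow-sum u i with u ≟ a | u ≟ b
    ... | yes refl | yes refl = ⊥-elim (a≢b refl)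
    ... | yes refl | no _ =
      trans (Σ-single (outflow a i) (c b i) (elim (λ y → ¬ y ≡ c b i → outflow a i y ≡ + 0) only-ab))
            (trans (edge-flow i a~b) (cong₂ (λ s t → height-of s - height-of t) side-a side-b))
      where
      height-of : Bool → ℤ
      height-of s = if s then + 1 else + 0
      only-ab : ∀ w j → ¬ c w j ≡ c b i → outflow a i (c w j) ≡ + 0
      only-ab w j not-bi = no-flow a i w j (λ { refl (_ , refl) → not-bi refl }) (λ { _ (a≡b , _) → a≢b a≡b })
    ... | no _ | yes refl =
      trans (Σ-single (outflow b i) (c a i) (elim (λ y → ¬ y ≡ c a i → outflow b i y ≡ + 0) only-ba))
            (trans (edge-flow i (trans (symT b a) a~b)) (cong₂ (λ s t → height-of s - height-of t) side-b side-a))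
      where
      height-of : Bool → ℤ
      height-of s = if s then + 1 else + 0
      only-ba : ∀ w j → ¬ c w j ≡ c a i → outflow b i (c w j) ≡ + 0
      only-ba w j not-ai = no-flow b i w j (λ { _ (b≡a , _) → a≢b (sym b≡a) }) (λ { refl (_ , refl) → not-ai refl })
    ... | no u≢a | no u≢b =
      Σ-zero (outflow u i) (elim (λ y → outflow u i y ≡ + 0)
        (λ w j → no-flow u i w j (λ { _ (u≡a , _) → u≢a u≡a }) (λ { _ (u≡b , _) → u≢b u≡b })))

    fibre-step : ∀ z → fibre b z - fibre a z ≡ Δ· G b-side z
    fibre-step = elim (λ z → fibre b z - fibre a z ≡ Δ· G b-side z) λ u i → begin
      δ b (base (c u i)) - δ a (base (c u i)) ≡⟨ cong₂ (λ p q → δ b p - δ a q) (base-c u i) (base-c u i) ⟩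
      δ b u - δ a u                           ≡⟨ sym (flow-sum u i) ⟩
      Σℤ (outflow u i)                        ≡⟨ sym (Δ·-as-flow G (loopless loopless-T) b-side (c u i)) ⟩
      Δ· G b-side (c u i)                     ∎
      where open ≡-Reasoning

  fibres-equivalent : ∀ {x w} → Walk T x w → ∃ λ f → ∀ z → fibre w z - fibre x z ≡ Δ· G f z
  fibres-equivalent {x} here = (λ _ → + 0) , λ z → trans (+-inverseʳ (fibre x z)) (sym (Δ·-zero G z))
  fibres-equivalent {x} {w} (step {w = y} x~y rest) with fibres-equivalent rest
  ... | f , y-to-w = (λ z → f z + b-side x~y z) , λ z →
    trans (telescope (fibre w z) (fibre y z) (fibre x z))
          (trans (cong₂ _+_ (y-to-w z) (fibre-step x~y z)) (sym (Δ·-+ G f (b-side x~y) z)))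
    where
    telescope : ∀ p q r → p - r ≡ (p - q) + (q - r)
    telescope = solve-∀

  fibre-points : ∀ w z → fibre w z ≡ δ (c w i₀) z + δ (c w i₁) z + δ (c w i₂) z
  fibre-points w = elim (λ z → fibre w z ≡ δ (c w i₀) z + δ (c w i₁) z + δ (c w i₂) z) λ u i →
    trans (cong (δ w) (base-c u i)) (by-cases u i)
    where
    by-cases : ∀ u i → δ w u ≡ δ (c w i₀) (c u i) + δ (c w i₁) (c u i) + δ (c w i₂) (c u i)
    by-cases u i with u ≟ w
    ... | no u≢w rewrite δ-other {a = c w i₀} (layer≢ {i = i} u≢w) | δ-other {a = c w i₁} (layer≢ {i = i} u≢w)
                       | δ-other {a = c w i₂} (layer≢ {i = i} u≢w) = refl
    ... | yes refl with i
    ...   | zero rewrite δ-same (c u i₀) | δ-other {a = c u i₁} {i = c u i₀} (fibre≢ (λ ()))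
                       | δ-other {a = c u i₂} {i = c u i₀} (fibre≢ (λ ())) = refl
    ...   | suc zero rewrite δ-same (c u i₁) | δ-other {a = c u i₀} {i = c u i₁} (fibre≢ (λ ()))
                       | δ-other {a = c u i₂} {i = c u i₁} (fibre≢ (λ ())) = refl
    ...   | suc (suc zero) rewrite δ-same (c u i₂) | δ-other {a = c u i₀} {i = c u i₂} (fibre≢ (λ ()))
                       | δ-other {a = c u i₁} {i = c u i₂} (fibre≢ (λ ())) = refl

  fibre-degree : ∀ w → deg G (fibre w) ≡ + 3
  fibre-degree w = begin
    Σℤ (fibre w)
      ≡⟨ Σ-cong (fibre-points w) ⟩
    Σℤ (λ z → δ (c w i₀) z + δ (c w i₁) z + δ (c w i₂) z)
      ≡⟨ Σ-+ (λ z → δ (c w i₀) z + δ (c w i₁) z) (δ (c w i₂)) ⟩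
    Σℤ (λ z → δ (c w i₀) z + δ (c w i₁) z) + Σℤ (δ (c w i₂))
      ≡⟨ cong (_+ Σℤ (δ (c w i₂))) (Σ-+ (δ (c w i₀)) (δ (c w i₁))) ⟩
    Σℤ (δ (c w i₀)) + Σℤ (δ (c w i₁)) + Σℤ (δ (c w i₂))
      ≡⟨ cong₂ _+_ (cong₂ _+_ (Σ-δ (c w i₀)) (Σ-δ (c w i₁))) (Σ-δ (c w i₂)) ⟩
    + 3 ∎
    where open ≡-Reasoning

  fibre-effective : ∀ w → Effective G (fibre w)
  fibre-effective w z = δ-nonneg w (base z)

  -- Each fibre has rank ≥ 1: a chip at x is absorbed by the fibre over the
  -- base of x, which is equivalent to the given fibre.
  fibre-rank : ∀ u → RankAtLeast G (fibre u) 1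
  fibre-rank u F F≥0 degF≡1 with degree-one F F≥0 degF≡1
  ... | x , F≡δx with fibres-equivalent (connected u (base x))
  ...   | f , u-to-x = E , E≥0 , f , λ z → trans (cancel (fibre (base x) z) (fibre u z) (F z)) (u-to-x z)
    where
    E : Divisor G
    E z = fibre (base x) z - F z
    E≥0 : Effective G E
    E≥0 z rewrite F≡δx z with z ≟ x
    ... | yes refl = ≤-reflexive (sym (cong (λ t → t - + 1) (δ-same (base x))))
    ... | no _ = subst (+ 0 ≤_) (sym (+-identityʳ (fibre (base x) z))) (fibre-effective (base x) z)
    cancel : ∀ p q s → (p - s) - (q - s) ≡ p - q
    cancel = solve-∀

other-vertex : ∀ {m} → 2 ℕ.≤ m → (u : Fin m) → ∃ λ w → ¬ u ≡ w
other-vertex (s≤s (s≤s _)) zero = suc zero , λ ()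
other-vertex (s≤s (s≤s _)) (suc _) = zero , λ ()

some-vertex : ∀ {m} → 2 ℕ.≤ m → Fin m
some-vertex (s≤s _) = zero

has-neighbour : (T : Graph) → Connected T → 2 ℕ.≤ size T → ∀ u → ∃ λ w → Adj T u w
has-neighbour T connected two u with other-vertex two u
... | w , u≢w with connected u w
...   | here = ⊥-elim (u≢w refl)
...   | step {w = v} u~v _ = v , u~v

module LowerBound (T : Graph) (symT : ∀ u v → adj T u v ≡ adj T v u)
  (loopless-T : ∀ v → adj T v v ≡ false) (connected : Connected T) (two : 2 ℕ.≤ size T)
  (D : Divisor (T □ K₃)) (D≥0 : Effective (T □ K₃) D) (rank≥1 : RankAtLeast (T □ K₃) D 1) where

  open Product T
  open ThreeChips D≥0

  -- If p carries no chip, remove one from p and compare with the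
  -- minimisers of the resulting potential.
  at-chipless : ∀ p → ¬ (+ 1 ≤ D p) → + 3 ≤ Σℤ D
  at-chipless p chipless with rank≥1 (δ p) (δ-nonneg p) (Σ-δ p)
  ... | E , E≥0 , f , E∼D-p with minimiser p f
  ...   | v₀ , v₀-min = some-non-minimiser
    where
    open MinimumCut G (loopless loopless-T) D E (δ p) f (δ-nonneg p) E≥0 E∼D-p v₀ v₀-min
    Min? : ∀ z → Dec (Min z)
    Min? z = f z ≤? f v₀
    open ProductCut T symT loopless-T connected (has-neighbour T connected two) D D≥0 Min Min? cut-bound
    some-non-minimiser : + 3 ≤ Σℤ D
    some-non-minimiser with all? Min?
    ... | yes all-min = ⊥-elim (chipless (subst (_≤ D p) (δ-same p) (constant⇒F≤D all-min p)))
    ... | no not-all = three-chips (≤-refl {f v₀}) (proj₂ (¬∀⟶∃¬ _ Min Min? not-all))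

  u₀ : Fin (size T)
  u₀ = some-vertex two

  degree≥3 : + 3 ≤ deg G D
  degree≥3 with + 1 ≤? D (c u₀ i₀) | + 1 ≤? D (c u₀ i₁) | + 1 ≤? D (c u₀ i₂)
  ... | yes one₀ | yes one₁ | yes one₂ =
    chips-111 _ _ _ (fibre≢ (λ ())) (fibre≢ (λ ())) (fibre≢ (λ ())) one₀ one₁ one₂
  ... | no none | _ | _ = at-chipless _ none
  ... | yes _ | no none | _ = at-chipless _ none
  ... | yes _ | yes _ | no none = at-chipless _ none

corollary5p2 : (T : Graph) → IsTree T → 2 ℕ.≤ size T → IsGonality (T □ K₃) 3
corollary5p2 T ((symT , loopless-T) , connected , acyclic) two =
  (fibre u₀ , fibre-effective u₀ , fibre-rank u₀ , fibre-degree u₀) ,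
  λ D D≥0 rank≥1 → LowerBound.degree≥3 T symT loopless-T connected two D D≥0 rank≥1
  where
  open Fibres T symT loopless-T connected acyclic
  u₀ : Fin (size T)
  u₀ = some-vertex two
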